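{- Let $G=(X,Y,E)$ be a connected chain graph whose proper ordered chain partition $X_1,\dots,X_k$, $Y_1,\dots,Y_k$ has $k\ge 3$. If $G$ has no pendent vertices, then $\gamma_{cs}(G)=4$.
   Context: All graphs are finite, simple, undirected, without isolated vertices. A set $S$ of vertices is a cosecure dominating set if every vertex outside $S$ has a neighbour in $S$ and for every $u\in S$ there is a neighbour $v\notin S$ of $u$ such that $(S\setminus\{u\})\cup\{v\}$ is still dominating; $\gamma_{cs}(G)$ is the minimum size of a cosecure dominating set. A pendent vertex is a vertex of degree $1$. A bipartite graph $G=(X,Y,E)$ is a chain graph if $X$ can be ordered $x_1,\dots,x_{n_1}$ with $N(x_1)\subseteq\cdots\subseteq N(x_{n_1})$. Partition $X$ into classes of the relation $x\sim x'\iff N(x)=N(x')$, indexed $X_1,\dots,X_k$ so that $N(X_1)\subsetneq\cdots\subsetneq N(X_k)$ ($N(X_i)$ the common neighbourhood of $X_i$). Set $Y_1=N(X_1)$ and $Y_i=N(X_i)\setminus\bigcup_{j<i}N(X_j)$ for $i\ge2$; this is the proper ordered chain partition. -}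

module Defs where

open import Data.Nat using (ℕ; _≤_)
open import Data.Bool using (Bool; true; false)
open import Data.Fin using (Fin)
open import Data.Fin.Subset using (Subset; _∈_; _∉_; _⊆_; ∣_∣; inside; outside)
open import Data.Vec using (tabulate; _[_]≔_)
open import Data.Product using (Σ; ∃; _×_; _,_)
open import Data.Sum using (_⊎_)
open import Relation.Binary.PropositionalEquality using (_≡_; _≢_)
open import Relation.Binary.Construct.Closure.ReflexiveTransitive using (Star)
open import Relation.Nullary using (¬_)

record Graph (n : ℕ) : Set where
  field
    adj       : Fin n → Fin n → Bool
    adj-sym   : ∀ u v → adj u v ≡ adj v u
    adj-irrefl : ∀ v → adj v v ≡ false

module _ {n : ℕ} (G : Graph n) where
  open Graph G

  Adj : Fin n → Fin n → Set
  Adj u v = adj u v ≡ true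

  N : Fin n → Subset n
  N v = tabulate (adj v)

  degree : Fin n → ℕ
  degree v = ∣ N v ∣

  NoIsolated : Set
  NoIsolated = ∀ v → ∃ λ u → Adj v u

  NoPendent : Set
  NoPendent = ∀ v → degree v ≢ 1

  Connected : Set
  Connected = ∀ u v → Star Adj u v

  Dominating : Subset n → Set
  Dominating S = ∀ v → v ∉ S → ∃ λ u → u ∈ S × Adj u v

  swap : Subset n → Fin n → Fin n → Subset n
  swap S u v = (S [ u ]≔ outside) [ v ]≔ inside

  CosecureDominating : Subset n → Set
  CosecureDominating S =
    Dominating S ×
    (∀ u → u ∈ S → ∃ λ v → v ∉ S × Adj u v × Dominating (swap S u v))

  γcs≡ : ℕ → Set
  γcs≡ m = (∃ λ S → CosecureDominating S × ∣ S ∣ ≡ m) ×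
           (∀ S → CosecureDominating S → m ≤ ∣ S ∣)

  -- G = (X, Y, E) bipartite, X = {v | side v ≡ true}, Y = {v | side v ≡ false};
  -- every edge joins X and Y.
  Bipartition : (Fin n → Bool) → Set
  Bipartition side = ∀ u v → Adj u v → side u ≢ side v

  ChainGraph : (Fin n → Bool) → Set
  ChainGraph side = Bipartition side ×
    (∀ x x' → side x ≡ true → side x' ≡ true → N x ⊆ N x' ⊎ N x' ⊆ N x)

  -- the proper ordered chain partition has k ≥ 3 classes: X contains at
  -- least three vertices with pairwise distinct neighbourhoods
  -- (the classes X_i are the classes of equal neighbourhood in X).
  AtLeast3Classes : (Fin n → Bool) → Set
  AtLeast3Classes side = Σ (Fin n) λ x₁ → Σ (Fin n) λ x₂ → Σ (Fin n) λ x₃ →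
    side x₁ ≡ true × side x₂ ≡ true × side x₃ ≡ true ×
    N x₁ ≢ N x₂ × N x₂ ≢ N x₃ × N x₁ ≢ N x₃

-- In a chain graph the neighbourhoods on each side are nested, so a vertex of least degree on
-- one side has the least neighbourhood there; its (at least two) neighbours are then adjacent
-- to the whole other side. Two such full vertices on each side form a cosecure dominating set:
-- a non-full vertex of the other side lies outside it, and exchanging a member for it leaves a
-- full vertex on both sides. Conversely, neighbourhoods N(a) ⊊ N(b) ⊊ N(c) of three classes
-- with |N(a)| ≥ 2 give four vertices on each side. A cosecure dominating set S with at most one
-- vertex t off a side contains, after exchanging t, that entire side, so |S| ≥ 4; otherwise S
-- has two vertices on each side.
module Submission where

open import Defs
open import Data.Bool as Bool using (Bool; true; false; not)
open import Data.Bool.Properties using (¬-not)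
open import Data.Empty using (⊥-elim)
open import Data.Fin using (Fin; zero; suc; _≟_)
open import Data.Fin.Properties using (any?)
open import Data.Fin.Subset
  using (Subset; _∈_; _∉_; _⊆_; _⊈_; _⊂_; ∣_∣; ⁅_⁆; inside; outside)
open import Data.Fin.Subset.Properties
  using (_∈?_; _⊆?_; x∈⁅x⁆; x∈⁅y⁆⇒x≡y; x∉⁅y⁆⇒x≢y; x≢y⇒x∉⁅y⁆; ∣⁅x⁆∣≡1;
         p⊆q⇒∣p∣≤∣q∣; p⊂q⇒∣p∣<∣q∣; ⊆-antisym)
open import Data.Nat using (ℕ; suc; _+_; _≤_; _<_; s≤s)
open import Data.Nat.Properties using (≤-trans; ≤-reflexive; ≤∧≢⇒<; <⇒≱; ≤-totalOrder)
open import Data.List using (filter; allFin)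
open import Data.List.Extrema ≤-totalOrder using (argmin; argmin-all; f[argmin]≤f[xs])
open import Data.List.Membership.Propositional.Properties using (∈-filter⁺; ∈-allFin)
open import Data.List.Relation.Unary.All using (lookup)
open import Data.List.Relation.Unary.All.Properties using (all-filter)
open import Data.Product using (∃; ∃₂; _×_; _,_; proj₁; proj₂)
open import Data.Sum using (_⊎_; inj₁; inj₂)
open import Data.Vec using (_∷_; _[_]≔_; here; there)
open import Data.Vec.Properties
  using (lookup∘update; lookup∘update′; []=⇒lookup; lookup⇒[]=; lookup∘tabulate)
open import Function using (_∘_)
open import Relation.Binary.PropositionalEquality
  using (_≡_; _≢_; refl; sym; trans; cong; subst; ≢-sym)
open import Relation.Nullary using (¬_; yes; no; ¬?)
open import Relation.Nullary.Decidable using (_×-dec_; decidable-stable)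

private
  variable
    n : ℕ
    p q : Subset n
    x y : Fin n

≢-≢⇒≡ : {a b c : Bool} → a ≢ b → c ≢ b → a ≡ c
≢-≢⇒≡ a≢b c≢b = trans (¬-not a≢b) (sym (¬-not c≢b))

≡true∧≡false⇒≢ : {a c : Bool} → a ≡ true → c ≡ false → a ≢ c
≡true∧≡false⇒≢ refl refl ()

infixl 6 _∪⁅_⁆ _─⁅_⁆

_∪⁅_⁆ : Subset n → Fin n → Subset n
p ∪⁅ x ⁆ = p [ x ]≔ inside

_─⁅_⁆ : Subset n → Fin n → Subset n
p ─⁅ x ⁆ = p [ x ]≔ outside

∈-update⁺ : ∀ b → x ≢ y → x ∈ p → x ∈ p [ y ]≔ b
∈-update⁺ {x = x} {p = p} b x≢y x∈p =
  lookup⇒[]= x _ (trans (lookup∘update′ x≢y p b) ([]=⇒lookup x∈p))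

∈-update⁻ : ∀ b → x ≢ y → x ∈ p [ y ]≔ b → x ∈ p
∈-update⁻ {x = x} {p = p} b x≢y x∈p′ =
  lookup⇒[]= x p (trans (sym (lookup∘update′ x≢y p b)) ([]=⇒lookup x∈p′))

x∈p∪⁅x⁆ : ∀ x (p : Subset n) → x ∈ p ∪⁅ x ⁆
x∈p∪⁅x⁆ x p = lookup⇒[]= x _ (lookup∘update x p inside)

x∉p─⁅x⁆ : ∀ x (p : Subset n) → x ∉ p ─⁅ x ⁆
x∉p─⁅x⁆ x p x∈ with trans (sym (lookup∘update x p outside)) ([]=⇒lookup x∈)
... | ()

x∈p⇒x∈p∪⁅y⁆ : x ∈ p → x ∈ p ∪⁅ y ⁆
x∈p⇒x∈p∪⁅y⁆ {x = x} {p = p} {y = y} x∈p with x ≟ y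
... | yes refl = x∈p∪⁅x⁆ x p
... | no x≢y   = ∈-update⁺ inside x≢y x∈p

x∈p∪⁅y⁆⁻ : x ∈ p ∪⁅ y ⁆ → x ≡ y ⊎ x ∈ p
x∈p∪⁅y⁆⁻ {x = x} {y = y} x∈ with x ≟ y
... | yes x≡y = inj₁ x≡y
... | no x≢y  = inj₂ (∈-update⁻ inside x≢y x∈)

x∉p∪⁅y⁆ : x ≢ y → x ∉ p → x ∉ p ∪⁅ y ⁆
x∉p∪⁅y⁆ x≢y x∉p x∈ with x∈p∪⁅y⁆⁻ x∈
... | inj₁ x≡y = x≢y x≡y
... | inj₂ x∈p = x∉p x∈p

x∈p─⁅y⁆⁻ : x ∈ p ─⁅ y ⁆ → x ∈ p × x ≢ y
x∈p─⁅y⁆⁻ {x = x} {p = p} {y = y} x∈ with x ≟ y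
... | yes refl = ⊥-elim (x∉p─⁅x⁆ x p x∈)
... | no x≢y   = ∈-update⁻ outside x≢y x∈ , x≢y

x∈p⇒x∈p─⁅u⁆∪⁅v⁆ : ∀ {u v} → x ∈ p → x ≢ u → x ∈ p ─⁅ u ⁆ ∪⁅ v ⁆
x∈p⇒x∈p─⁅u⁆∪⁅v⁆ x∈p x≢u = x∈p⇒x∈p∪⁅y⁆ (∈-update⁺ outside x≢u x∈p)

∪⁅⁆⊆ : x ∈ q → p ⊆ q → p ∪⁅ x ⁆ ⊆ q
∪⁅⁆⊆ x∈q p⊆q y∈ with x∈p∪⁅y⁆⁻ y∈
... | inj₁ refl = x∈q
... | inj₂ y∈p  = p⊆q y∈p

⁅⁆⊆ : x ∈ q → ⁅ x ⁆ ⊆ q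
⁅⁆⊆ {x = x} x∈q y∈ with x∈⁅y⁆⇒x≡y x y∈
... | refl = x∈q

∣p∪⁅x⁆∣≡1+∣p∣ : x ∉ p → ∣ p ∪⁅ x ⁆ ∣ ≡ suc ∣ p ∣
∣p∪⁅x⁆∣≡1+∣p∣ {x = zero}  {p = true ∷ p}  x∉p = ⊥-elim (x∉p here)
∣p∪⁅x⁆∣≡1+∣p∣ {x = zero}  {p = false ∷ p} x∉p = refl
∣p∪⁅x⁆∣≡1+∣p∣ {x = suc x} {p = true ∷ p}  x∉p = cong suc (∣p∪⁅x⁆∣≡1+∣p∣ (x∉p ∘ there))
∣p∪⁅x⁆∣≡1+∣p∣ {x = suc x} {p = false ∷ p} x∉p = ∣p∪⁅x⁆∣≡1+∣p∣ (x∉p ∘ there)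

∣p∣≡1+∣p─⁅x⁆∣ : x ∈ p → ∣ p ∣ ≡ suc ∣ p ─⁅ x ⁆ ∣
∣p∣≡1+∣p─⁅x⁆∣ here                        = refl
∣p∣≡1+∣p─⁅x⁆∣ {p = true ∷ p}  (there x∈p) = cong suc (∣p∣≡1+∣p─⁅x⁆∣ x∈p)
∣p∣≡1+∣p─⁅x⁆∣ {p = false ∷ p} (there x∈p) = ∣p∣≡1+∣p─⁅x⁆∣ x∈p

∣p─⁅x⁆∪⁅y⁆∣≡∣p∣ : x ∈ p → y ∉ p → ∣ p ─⁅ x ⁆ ∪⁅ y ⁆ ∣ ≡ ∣ p ∣
∣p─⁅x⁆∪⁅y⁆∣≡∣p∣ x∈p y∉p =
  trans (∣p∪⁅x⁆∣≡1+∣p∣ (y∉p ∘ proj₁ ∘ x∈p─⁅y⁆⁻)) (sym (∣p∣≡1+∣p─⁅x⁆∣ x∈p))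

∣⁅a,b,c,d⁆∣≡4 : ∀ {a b c d : Fin n} → a ≢ b → a ≢ c → a ≢ d → b ≢ c → b ≢ d → c ≢ d →
  ∣ ⁅ a ⁆ ∪⁅ b ⁆ ∪⁅ c ⁆ ∪⁅ d ⁆ ∣ ≡ 4
∣⁅a,b,c,d⁆∣≡4 {a = a} a≢b a≢c a≢d b≢c b≢d c≢d
  rewrite ∣p∪⁅x⁆∣≡1+∣p∣ (x∉p∪⁅y⁆ (≢-sym c≢d) (x∉p∪⁅y⁆ (≢-sym b≢d) (x≢y⇒x∉⁅y⁆ (≢-sym a≢d))))
        | ∣p∪⁅x⁆∣≡1+∣p∣ (x∉p∪⁅y⁆ (≢-sym b≢c) (x≢y⇒x∉⁅y⁆ (≢-sym a≢c)))
        | ∣p∪⁅x⁆∣≡1+∣p∣ (x≢y⇒x∉⁅y⁆ (≢-sym a≢b))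
        | ∣⁅x⁆∣≡1 a
        = refl

four-distinct⇒4≤∣p∣ : ∀ {a b c d : Fin n} → a ∈ p → b ∈ p → c ∈ p → d ∈ p →
  a ≢ b → a ≢ c → a ≢ d → b ≢ c → b ≢ d → c ≢ d → 4 ≤ ∣ p ∣
four-distinct⇒4≤∣p∣ a∈p b∈p c∈p d∈p a≢b a≢c a≢d b≢c b≢d c≢d =
  subst (_≤ _) (∣⁅a,b,c,d⁆∣≡4 a≢b a≢c a≢d b≢c b≢d c≢d)
    (p⊆q⇒∣p∣≤∣q∣ (∪⁅⁆⊆ d∈p (∪⁅⁆⊆ c∈p (∪⁅⁆⊆ b∈p (⁅⁆⊆ a∈p)))))

p⊈q⇒∃x∈p∖q : p ⊈ q → ∃ λ x → x ∈ p × x ∉ q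
p⊈q⇒∃x∈p∖q {p = p} {q = q} p⊈q with any? (λ x → x ∈? p ×-dec ¬? (x ∈? q))
... | yes witness = witness
... | no none = ⊥-elim (p⊈q λ {x} x∈p →
        decidable-stable (x ∈? q) (λ x∉q → none (x , x∈p , x∉q)))

∣p∣<∣q∣⇒∃x∈q∖p : ∣ p ∣ < ∣ q ∣ → ∃ λ x → x ∈ q × x ∉ p
∣p∣<∣q∣⇒∃x∈q∖p ∣p∣<∣q∣ = p⊈q⇒∃x∈p∖q (<⇒≱ ∣p∣<∣q∣ ∘ p⊆q⇒∣p∣≤∣q∣)

p⊆q∧p≢q⇒p⊂q : p ⊆ q → p ≢ q → p ⊂ q
p⊆q∧p≢q⇒p⊂q p⊆q p≢q = p⊆q , p⊈q⇒∃x∈p∖q (p≢q ∘ ⊆-antisym p⊆q)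

comparable∧∣p∣≤∣q∣⇒p⊆q : p ⊆ q ⊎ q ⊆ p → ∣ p ∣ ≤ ∣ q ∣ → p ⊆ q
comparable∧∣p∣≤∣q∣⇒p⊆q (inj₁ p⊆q) _ = p⊆q
comparable∧∣p∣≤∣q∣⇒p⊆q {p = p} {q = q} (inj₂ q⊆p) ∣p∣≤∣q∣ with p ⊆? q
... | yes p⊆q = p⊆q
... | no p⊈q  = ⊥-elim (<⇒≱ (p⊂q⇒∣p∣<∣q∣ (q⊆p , p⊈q⇒∃x∈p∖q p⊈q)) ∣p∣≤∣q∣)

module _ {n : ℕ} (G : Graph n) where

  Adj⇒∈N : ∀ {u v} → Adj G u v → v ∈ N G u
  Adj⇒∈N {u} {v} u~v = lookup⇒[]= v _ (trans (lookup∘tabulate (Graph.adj G u) v) u~v)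

  ∈N⇒Adj : ∀ {u v} → v ∈ N G u → Adj G u v
  ∈N⇒Adj {u} {v} v∈N = trans (sym (lookup∘tabulate (Graph.adj G u) v)) ([]=⇒lookup v∈N)

  Adj-sym : ∀ {u v} → Adj G u v → Adj G v u
  Adj-sym {u} {v} = trans (Graph.adj-sym G v u)

  ∈N-sym : ∀ {u v} → v ∈ N G u → u ∈ N G v
  ∈N-sym = Adj⇒∈N ∘ Adj-sym ∘ ∈N⇒Adj

  2≤degree : NoIsolated G → NoPendent G → ∀ v → 2 ≤ degree G v
  2≤degree noIso noPend v with noIso v
  ... | u , v~u = ≤∧≢⇒< 1≤degree (noPend v ∘ sym)
    where
    1≤degree : 1 ≤ degree G v
    1≤degree = subst (_≤ degree G v) (∣⁅x⁆∣≡1 u) (p⊆q⇒∣p∣≤∣q∣ (⁅⁆⊆ (Adj⇒∈N v~u)))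

  two-neighbours : NoIsolated G → NoPendent G →
    ∀ v → ∃₂ λ u w → Adj G v u × Adj G v w × u ≢ w
  two-neighbours noIso noPend v with noIso v
  ... | u , v~u with ∣p∣<∣q∣⇒∃x∈q∖p {p = ⁅ u ⁆}
                       (subst (_< degree G v) (sym (∣⁅x⁆∣≡1 u)) (2≤degree noIso noPend v))
  ... | w , w∈N , w∉⁅u⁆ = u , w , v~u , ∈N⇒Adj w∈N , ≢-sym (x∉⁅y⁆⇒x≢y w∉⁅u⁆)

module Bipartite {n : ℕ} (G : Graph n) (side : Fin n → Bool) (bip : Bipartition G side) where

  Nested : Bool → Set
  Nested b = ∀ x x' → side x ≡ b → side x' ≡ b → N G x ⊆ N G x' ⊎ N G x' ⊆ N G x

  OnSide : Bool → Subset n → Set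
  OnSide b T = ∀ {t} → t ∈ T → side t ≡ b

  Minimal : Fin n → Set
  Minimal m = ∀ z → side z ≡ side m → N G m ⊆ N G z

  Full : Fin n → Set
  Full v = ∀ w → side w ≢ side v → Adj G v w

  N-OnSide-opposite : ∀ u → OnSide (not (side u)) (N G u)
  N-OnSide-opposite u {t} t∈N = ¬-not (bip u t (∈N⇒Adj G t∈N) ∘ sym)

  nested-opposite : ∀ {b b'} → b ≢ b' → Nested b → Nested b'
  nested-opposite {b} {b'} b≢b' nested y y' sy sy' with N G y ⊆? N G y'
  ... | yes Ny⊆Ny' = inj₁ Ny⊆Ny'
  ... | no Ny⊈Ny' with p⊈q⇒∃x∈p∖q Ny⊈Ny'
  ... | x , x∈Ny , x∉Ny' = inj₂ Ny'⊆Ny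
    where
    on-b : ∀ {z t} → side z ≡ b' → t ∈ N G z → side t ≡ b
    on-b {z} {t} sz t∈N = ≢-≢⇒≡ (λ st → bip z t (∈N⇒Adj G t∈N) (trans sz (sym st))) b≢b'

    Ny'⊆Ny : N G y' ⊆ N G y
    Ny'⊆Ny x'∈Ny' with nested x _ (on-b sy x∈Ny) (on-b sy' x'∈Ny')
    ... | inj₁ Nx⊆Nx' = ∈N-sym G (Nx⊆Nx' (∈N-sym G x∈Ny))
    ... | inj₂ Nx'⊆Nx = ⊥-elim (x∉Ny' (∈N-sym G (Nx'⊆Nx (∈N-sym G x'∈Ny'))))

  minimal-exists : ∀ {a b} → Nested b → side a ≡ b → ∃ λ m → side m ≡ b × Minimal m
  minimal-exists {a} {b} nested sa = m , side-m , minimal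
    where
    on-b? = λ v → side v Bool.≟ b
    candidates = filter on-b? (allFin n)
    m = argmin (degree G) a candidates

    side-m : side m ≡ b
    side-m = argmin-all (degree G) sa (all-filter on-b? (allFin n))

    minimal : Minimal m
    minimal z sz = comparable∧∣p∣≤∣q∣⇒p⊆q (nested m z side-m sz′)
      (lookup (f[argmin]≤f[xs] a candidates) (∈-filter⁺ on-b? (∈-allFin z) sz′))
      where sz′ = trans sz side-m

  minimal⇒neighbour-full : ∀ {m v} → Minimal m → Adj G m v → Full v
  minimal⇒neighbour-full {m} {v} minimal m~v w sw≢sv =
    Adj-sym G (∈N⇒Adj G (minimal w (≢-≢⇒≡ sw≢sv (bip m v m~v)) (Adj⇒∈N G m~v)))

  full-pair-dominates : ∀ {D u v} → u ∈ D → v ∈ D → Full u → Full v → side u ≢ side v →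
    Dominating G D
  full-pair-dominates {u = u} {v} u∈D v∈D full-u full-v su≢sv w _ with side w Bool.≟ side u
  ... | yes sw≡su = v , v∈D , full-v w (su≢sv ∘ trans (sym sw≡su))
  ... | no sw≢su  = u , u∈D , full-u w sw≢su

  ¬Adj⇒opposite-non-full : ∀ {x y} → ¬ Adj G x y → side x ≢ side y →
    ∀ u → ∃ λ v → side v ≢ side u × ¬ Full v
  ¬Adj⇒opposite-non-full {x} {y} x≁y sx≢sy u with side u Bool.≟ side x
  ... | yes su≡sx = y , (λ sy≡su → sx≢sy (sym (trans sy≡su su≡sx))) ,
                    λ full-y → x≁y (Adj-sym G (full-y x sx≢sy))
  ... | no su≢sx  = x , su≢sx ∘ sym , λ full-x → x≁y (full-x y (sx≢sy ∘ sym))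

  dominating-OnSide⇒⊇ : ∀ {D T b} → Dominating G D → OnSide b D → OnSide b T → T ⊆ D
  dominating-OnSide⇒⊇ {D} dom D-on T-on {t} t∈T with t ∈? D
  ... | yes t∈D = t∈D
  ... | no t∉D with dom t t∉D
  ... | u , u∈D , u~t = ⊥-elim (bip u t u~t (trans (D-on u∈D) (sym (T-on t∈T))))

  cosecure-side-bound : ∀ {S T b} → CosecureDominating G S → OnSide b T →
    ∣ T ∣ ≤ ∣ S ∣ ⊎ ∃₂ λ t t' → t ∈ S × t' ∈ S × t ≢ t' × side t ≢ b × side t' ≢ b
  cosecure-side-bound {S} {T} {b} (dom , exchange) T-on
    with any? (λ t → t ∈? S ×-dec ¬? (side t Bool.≟ b))
  ... | no none = inj₁ (p⊆q⇒∣p∣≤∣q∣ (dominating-OnSide⇒⊇ dom S-on T-on))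
    where
    S-on : OnSide b S
    S-on {t} t∈S = decidable-stable (side t Bool.≟ b) (λ st≢b → none (t , t∈S , st≢b))
  ... | yes (t , t∈S , st≢b)
    with any? (λ t' → t' ∈? S ×-dec ¬? (side t' Bool.≟ b) ×-dec ¬? (t' ≟ t))
  ...   | yes (t' , t'∈S , st'≢b , t'≢t) = inj₂ (t , t' , t∈S , t'∈S , ≢-sym t'≢t , st≢b , st'≢b)
  ...   | no none with exchange t t∈S
  ...     | v , v∉S , t~v , dom′ =
    inj₁ (≤-trans (p⊆q⇒∣p∣≤∣q∣ (dominating-OnSide⇒⊇ dom′ S′-on T-on))
                  (≤-reflexive (∣p─⁅x⁆∪⁅y⁆∣≡∣p∣ t∈S v∉S)))
    where
    S′-on : OnSide b (swap G S t v)
    S′-on {w} w∈S′ with x∈p∪⁅y⁆⁻ w∈S′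
    ... | inj₁ refl = ≢-≢⇒≡ (bip t w t~v ∘ sym) (≢-sym st≢b)
    ... | inj₂ w∈S─t with x∈p─⁅y⁆⁻ w∈S─t
    ... | w∈S , w≢t = decidable-stable (side w Bool.≟ b) (λ sw≢b → none (w , w∈S , sw≢b , w≢t))

  cosecure⇒4≤∣S∣ : ∀ {S X Y} → CosecureDominating G S →
    OnSide true X → 4 ≤ ∣ X ∣ → OnSide false Y → 4 ≤ ∣ Y ∣ → 4 ≤ ∣ S ∣
  cosecure⇒4≤∣S∣ cs X-on 4≤∣X∣ Y-on 4≤∣Y∣
    with cosecure-side-bound cs X-on | cosecure-side-bound cs Y-on
  ... | inj₁ ∣X∣≤∣S∣ | _            = ≤-trans 4≤∣X∣ ∣X∣≤∣S∣
  ... | inj₂ _       | inj₁ ∣Y∣≤∣S∣ = ≤-trans 4≤∣Y∣ ∣Y∣≤∣S∣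
  ... | inj₂ (t , t' , t∈S , t'∈S , t≢t' , st , st')
      | inj₂ (s , s' , s∈S , s'∈S , s≢s' , ss , ss') =
    four-distinct⇒4≤∣p∣ t∈S t'∈S s∈S s'∈S
      t≢t' (apart st ss) (apart st ss') (apart st' ss) (apart st' ss') s≢s'
    where
    apart : ∀ {v w} → side v ≢ true → side w ≢ false → v ≢ w
    apart sv≢true sw≢false refl = sw≢false (¬-not sv≢true)

  record FullPair (b : Bool) : Set where
    field
      x₁ x₂   : Fin n
      x₁≢x₂   : x₁ ≢ x₂
      side-x₁ : side x₁ ≡ b
      side-x₂ : side x₂ ≡ b
      full-x₁ : Full x₁
      full-x₂ : Full x₂

    Member : Fin n → Set
    Member w = w ≡ x₁ ⊎ w ≡ x₂

    member-side : ∀ {w} → Member w → side w ≡ b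
    member-side (inj₁ refl) = side-x₁
    member-side (inj₂ refl) = side-x₂

    member-full : ∀ {w} → Member w → Full w
    member-full (inj₁ refl) = full-x₁
    member-full (inj₂ refl) = full-x₂

    member-avoiding : ∀ u → ∃ λ w → Member w × w ≢ u
    member-avoiding u with x₁ ≟ u
    ... | yes refl = x₂ , inj₂ refl , ≢-sym x₁≢x₂
    ... | no x₁≢u   = x₁ , inj₁ refl , x₁≢u

  fullPair : NoIsolated G → NoPendent G → ∀ {a b} → Nested b → side a ≡ b → FullPair (not b)
  fullPair noIso noPend nested sa with minimal-exists nested sa
  ... | m , refl , minimal with two-neighbours G noIso noPend m
  ... | u , w , m~u , m~w , u≢w = record
    { x₁      = u
    ; x₂      = w
    ; x₁≢x₂    = u≢w
    ; side-x₁  = N-OnSide-opposite m (Adj⇒∈N G m~u)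
    ; side-x₂ = N-OnSide-opposite m (Adj⇒∈N G m~w)
    ; full-x₁  = minimal⇒neighbour-full minimal m~u
    ; full-x₂ = minimal⇒neighbour-full minimal m~w
    }

  module _ (X : FullPair true) (Y : FullPair false) where
    private
      module X = FullPair X
      module Y = FullPair Y

    fullFour : Subset n
    fullFour = ⁅ X.x₁ ⁆ ∪⁅ X.x₂ ⁆ ∪⁅ Y.x₁ ⁆ ∪⁅ Y.x₂ ⁆

    private
      X-Y-apart : ∀ {v w} → X.Member v → Y.Member w → side v ≢ side w
      X-Y-apart v∈X w∈Y = ≡true∧≡false⇒≢ (X.member-side v∈X) (Y.member-side w∈Y)

      X-Y-distinct : ∀ {v w} → X.Member v → Y.Member w → v ≢ w
      X-Y-distinct v∈X w∈Y = X-Y-apart v∈X w∈Y ∘ cong side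

      member⇒∈ : ∀ {w} → X.Member w ⊎ Y.Member w → w ∈ fullFour
      member⇒∈ (inj₁ (inj₁ refl)) = x∈p⇒x∈p∪⁅y⁆ (x∈p⇒x∈p∪⁅y⁆ (x∈p⇒x∈p∪⁅y⁆ (x∈⁅x⁆ _)))
      member⇒∈ (inj₁ (inj₂ refl)) = x∈p⇒x∈p∪⁅y⁆ (x∈p⇒x∈p∪⁅y⁆ (x∈p∪⁅x⁆ _ _))
      member⇒∈ (inj₂ (inj₁ refl)) = x∈p⇒x∈p∪⁅y⁆ (x∈p∪⁅x⁆ _ _)
      member⇒∈ (inj₂ (inj₂ refl)) = x∈p∪⁅x⁆ _ _

      ∈⇒member : ∀ {w} → w ∈ fullFour → X.Member w ⊎ Y.Member w
      ∈⇒member w∈ with x∈p∪⁅y⁆⁻ w∈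
      ... | inj₁ refl = inj₂ (inj₂ refl)
      ... | inj₂ w∈₃ with x∈p∪⁅y⁆⁻ w∈₃
      ... | inj₁ refl = inj₂ (inj₁ refl)
      ... | inj₂ w∈₂ with x∈p∪⁅y⁆⁻ w∈₂
      ... | inj₁ refl = inj₁ (inj₂ refl)
      ... | inj₂ w∈₁ = inj₁ (inj₁ (x∈⁅y⁆⇒x≡y _ w∈₁))

      ∈⇒full : ∀ {w} → w ∈ fullFour → Full w
      ∈⇒full w∈ with ∈⇒member w∈
      ... | inj₁ w∈X = X.member-full w∈X
      ... | inj₂ w∈Y = Y.member-full w∈Y

    ∣fullFour∣≡4 : ∣ fullFour ∣ ≡ 4
    ∣fullFour∣≡4 = ∣⁅a,b,c,d⁆∣≡4 X.x₁≢x₂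
      (X-Y-distinct (inj₁ refl) (inj₁ refl)) (X-Y-distinct (inj₁ refl) (inj₂ refl))
      (X-Y-distinct (inj₂ refl) (inj₁ refl)) (X-Y-distinct (inj₂ refl) (inj₂ refl)) Y.x₁≢x₂

    fullFour-cosecure : (∀ u → ∃ λ v → side v ≢ side u × ¬ Full v) →
      CosecureDominating G fullFour
    fullFour-cosecure non-full =
      full-pair-dominates (member⇒∈ (inj₁ (inj₁ refl))) (member⇒∈ (inj₂ (inj₁ refl)))
        X.full-x₁ Y.full-x₁ (X-Y-apart (inj₁ refl) (inj₁ refl)) ,
      exchange
      where
      exchange : ∀ u → u ∈ fullFour →
        ∃ λ v → v ∉ fullFour × Adj G u v × Dominating G (swap G fullFour u v)
      exchange u u∈ with non-full u | X.member-avoiding u | Y.member-avoiding u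
      ... | v , sv≢su , ¬full-v | w , w∈X , w≢u | w' , w'∈Y , w'≢u =
        v , ¬full-v ∘ ∈⇒full , ∈⇒full u∈ v sv≢su ,
        full-pair-dominates
          (x∈p⇒x∈p─⁅u⁆∪⁅v⁆ (member⇒∈ (inj₁ w∈X)) w≢u)
          (x∈p⇒x∈p─⁅u⁆∪⁅v⁆ (member⇒∈ (inj₂ w'∈Y)) w'≢u)
          (X.member-full w∈X) (Y.member-full w'∈Y) (X-Y-apart w∈X w'∈Y)

  record ClassChain : Set where
    constructor chain
    field
      a b c  : Fin n
      side-a : side a ≡ true
      side-b : side b ≡ true
      side-c : side c ≡ true
      a⊂b    : N G a ⊂ N G b
      b⊂c    : N G b ⊂ N G c

    r : Fin n
    r = proj₁ (proj₂ b⊂c)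

    r∈Nc : r ∈ N G c
    r∈Nc = proj₁ (proj₂ (proj₂ b⊂c))

    r∉Nb : r ∉ N G b
    r∉Nb = proj₂ (proj₂ (proj₂ b⊂c))

    Nc-on : OnSide false (N G c)
    Nc-on t∈Nc = trans (N-OnSide-opposite c t∈Nc) (cong not side-c)

    side-r : side r ≡ false
    side-r = Nc-on r∈Nc

    b≁r : ¬ Adj G b r
    b≁r = r∉Nb ∘ Adj⇒∈N G

    side-b≢side-r : side b ≢ side r
    side-b≢side-r = ≡true∧≡false⇒≢ side-b side-r

    4≤∣Nc∣ : NoIsolated G → NoPendent G → 4 ≤ ∣ N G c ∣
    4≤∣Nc∣ noIso noPend =
      ≤-trans (s≤s (≤-trans (s≤s (2≤degree G noIso noPend a)) (p⊂q⇒∣p∣<∣q∣ a⊂b)))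
              (p⊂q⇒∣p∣<∣q∣ b⊂c)

    Nr∪⁅a⁆∪⁅b⁆-on : OnSide true (N G r ∪⁅ a ⁆ ∪⁅ b ⁆)
    Nr∪⁅a⁆∪⁅b⁆-on t∈ with x∈p∪⁅y⁆⁻ t∈
    ... | inj₁ refl = side-b
    ... | inj₂ t∈Nr∪a with x∈p∪⁅y⁆⁻ t∈Nr∪a
    ... | inj₁ refl = side-a
    ... | inj₂ t∈Nr = trans (N-OnSide-opposite r t∈Nr) (cong not side-r)

    4≤∣Nr∪⁅a⁆∪⁅b⁆∣ : NoIsolated G → NoPendent G → 4 ≤ ∣ N G r ∪⁅ a ⁆ ∪⁅ b ⁆ ∣
    4≤∣Nr∪⁅a⁆∪⁅b⁆∣ noIso noPend =
      subst (4 ≤_) (sym ∣Nr∪⁅a⁆∪⁅b⁆∣≡2+∣Nr∣) (s≤s (s≤s (2≤degree G noIso noPend r)))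
      where
      a∉Nr : a ∉ N G r
      a∉Nr = r∉Nb ∘ proj₁ a⊂b ∘ ∈N-sym G

      b∉Nr : b ∉ N G r
      b∉Nr = r∉Nb ∘ ∈N-sym G

      b≢a : b ≢ a
      b≢a b≡a with proj₂ a⊂b
      ... | t , t∈Nb , t∉Na = t∉Na (subst (λ v → t ∈ N G v) b≡a t∈Nb)

      ∣Nr∪⁅a⁆∪⁅b⁆∣≡2+∣Nr∣ : ∣ N G r ∪⁅ a ⁆ ∪⁅ b ⁆ ∣ ≡ 2 + ∣ N G r ∣
      ∣Nr∪⁅a⁆∪⁅b⁆∣≡2+∣Nr∣ = trans (∣p∪⁅x⁆∣≡1+∣p∣ (x∉p∪⁅y⁆ b≢a b∉Nr)) (cong suc (∣p∪⁅x⁆∣≡1+∣p∣ a∉Nr))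

  compare-classes : Nested true → ∀ {x y} → side x ≡ true → side y ≡ true → N G x ≢ N G y →
    N G x ⊂ N G y ⊎ N G y ⊂ N G x
  compare-classes nested {x} {y} sx sy Nx≢Ny with nested x y sx sy
  ... | inj₁ Nx⊆Ny = inj₁ (p⊆q∧p≢q⇒p⊂q Nx⊆Ny Nx≢Ny)
  ... | inj₂ Ny⊆Nx = inj₂ (p⊆q∧p≢q⇒p⊂q Ny⊆Nx (Nx≢Ny ∘ sym))

  AtLeast3Classes⇒ClassChain : Nested true → AtLeast3Classes G side → ClassChain
  AtLeast3Classes⇒ClassChain nested (x , y , z , sx , sy , sz , Nx≢Ny , Ny≢Nz , Nx≢Nz)
    with compare-classes nested sx sy Nx≢Ny
       | compare-classes nested sy sz Ny≢Nz
       | compare-classes nested sx sz Nx≢Nz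
  ... | inj₁ x⊂y | inj₁ y⊂z | _        = chain x y z sx sy sz x⊂y y⊂z
  ... | inj₁ x⊂y | inj₂ z⊂y | inj₁ x⊂z = chain x z y sx sz sy x⊂z z⊂y
  ... | inj₁ x⊂y | inj₂ z⊂y | inj₂ z⊂x = chain z x y sz sx sy z⊂x x⊂y
  ... | inj₂ y⊂x | inj₁ y⊂z | inj₁ x⊂z = chain y x z sy sx sz y⊂x x⊂z
  ... | inj₂ y⊂x | inj₁ y⊂z | inj₂ z⊂x = chain y z x sy sz sx y⊂z z⊂x
  ... | inj₂ y⊂x | inj₂ z⊂y | _        = chain z y x sz sy sx z⊂y y⊂x

mainTheorem16 : (n : ℕ) (G : Graph n) (side : Fin n → Bool) →
    NoIsolated G → Connected G → ChainGraph G side →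
    AtLeast3Classes G side → NoPendent G → γcs≡ G 4
mainTheorem16 n G side noIso _ (bip , nested-true) three noPend =
  (fullFour X Y , fullFour-cosecure X Y non-full , ∣fullFour∣≡4 X Y) ,
  λ S cs → cosecure⇒4≤∣S∣ cs C.Nr∪⁅a⁆∪⁅b⁆-on (C.4≤∣Nr∪⁅a⁆∪⁅b⁆∣ noIso noPend)
                             C.Nc-on (C.4≤∣Nc∣ noIso noPend)
  where
  open Bipartite G side bip

  C : ClassChain
  C = AtLeast3Classes⇒ClassChain nested-true three
  module C = ClassChain C

  X : FullPair true
  X = fullPair noIso noPend (nested-opposite (λ ()) nested-true) C.side-r

  Y : FullPair false
  Y = fullPair noIso noPend nested-true C.side-a

  non-full : ∀ u → ∃ λ v → side v ≢ side u × ¬ Full v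
  non-full = ¬Adj⇒opposite-non-full C.b≁r C.side-b≢side-r
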